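{- Let $k\geq 0$ and $\lambda=(1^{k})$. Then $a_{\lambda,h}=1$ for all $0\leq h\leq k$.
   Context: $(1^k)=(1,1,\ldots,1)$ ($k$ ones) is the partition of $k$ whose Young diagram is a single column. For a partition $\mu=(\mu_1,\ldots,\mu_\ell)$ of $m$ and $n-m\ge\mu_1$, $(n-m,\mu)=(n-m,\mu_1,\ldots,\mu_\ell)\vdash n$; $f^{\nu}$ is the number of standard Young tableaux of shape $\nu$. There is a polynomial $p_\mu\in\mathbb{Q}[x]$ of degree $m$ with $f^{(n-m,\mu)}=p_\mu(n)$ for all large $n$, and $a_{\mu,h}\in\mathbb{Q}$ ($0\le h\le m$) are the unique numbers with $f^{(n-m,\mu)}=\sum_{h=0}^{m}(-1)^{h}a_{\mu,h}\binom{n}{m-h}$ for all sufficiently large integers $n$. -}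

module Defs where

open import Data.Bool using (Bool; true; false; _∧_; T)
open import Data.Nat using (ℕ; zero; suc; _<ᵇ_; _≡ᵇ_; _∸_; _≥_)
open import Data.Nat.Combinatorics using (_C_)
open import Data.List using (List; []; _∷_; length; concat; map; upTo; replicate; foldr)
open import Data.Nat.ListAction using (sum)
open import Data.Bool.ListAction using (all; any)
open import Data.Fin using (Fin; toℕ)
open import Data.Fin.Base using ()
open import Data.List using (allFin)
open import Data.Product using (Σ; ∃; _×_)
open import Data.Rational using (ℚ; -_; _+_; _*_; 0ℚ; 1ℚ)
import Data.Rational as ℚ
open import Data.Integer using (+_)
open import Function.Bundles using (_↔_)
open import Relation.Binary.PropositionalEquality using (_≡_)

-- A partition / Young diagram shape is a list of row lengths (ν₁, ν₂, …).
-- A tableau is a list of rows, each row a list of entries (top row first).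

increasing : List ℕ → Bool
increasing (x ∷ y ∷ r) = (x <ᵇ y) ∧ increasing (y ∷ r)
increasing _ = true

belowOK : List ℕ → List ℕ → Bool
belowOK (x ∷ xs) (y ∷ ys) = (x <ᵇ y) ∧ belowOK xs ys
belowOK _ [] = true
belowOK [] (_ ∷ _) = false

columnsOK : List (List ℕ) → Bool
columnsOK (r ∷ r' ∷ rs) = belowOK r r' ∧ columnsOK (r' ∷ rs)
columnsOK _ = true

hasShape : List (List ℕ) → List ℕ → Bool
hasShape [] [] = true
hasShape (r ∷ rs) (l ∷ ls) = (length r ≡ᵇ l) ∧ hasShape rs ls
hasShape _ _ = false

member : ℕ → List ℕ → Bool
member i xs = any (λ x → x ≡ᵇ i) xs

contentOK : List (List ℕ) → ℕ → Bool
contentOK t n = (length (concat t) ≡ᵇ n) ∧ all (λ i → member i (concat t)) (map suc (upTo n))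

isSYT : List ℕ → List (List ℕ) → Bool
isSYT ν t = hasShape t ν ∧ (all increasing t ∧ (columnsOK t ∧ contentOK t (sum ν)))

SYT : List ℕ → Set
SYT ν = Σ (List (List ℕ)) (λ t → T (isSYT ν t))

HasSYTCount : List ℕ → ℕ → Set
HasSYTCount ν m = Fin m ↔ SYT ν

hook : ℕ → ℕ → List ℕ → List ℕ
hook n m μ = (n ∸ m) ∷ μ

column : ℕ → List ℕ
column k = replicate k 1

sgn : ℕ → ℚ
sgn zero = 1ℚ
sgn (suc h) = - sgn h

ℕ→ℚ : ℕ → ℚ
ℕ→ℚ m = (+ m) ℚ./ 1

expansion : (m : ℕ) → (Fin (suc m) → ℚ) → ℕ → ℚ
expansion m a n =
  foldr _+_ 0ℚ (map (λ h → sgn (toℕ h) * (a h * ℕ→ℚ (n C (m ∸ toℕ h)))) (allFin (suc m)))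

IsCoeffFamily : (μ : List ℕ) → (Fin (suc (sum μ)) → ℚ) → Set
IsCoeffFamily μ a =
  ∃ λ N → ∀ n → n ≥ N → ∃ λ f → HasSYTCount (hook n (sum μ) μ) f × (ℕ→ℚ f ≡ expansion (sum μ) a n)

-- A standard tableau of shape (n - k, 1ᵏ), n = m + 1, is determined by the k entries among
-- 2, …, m + 1 filling its column, so f^(n-k,1ᵏ) = C(n - 1, k) = Σ_h (-1)^h C(n, k - h) by Pascal's
-- rule, and the all-ones family works. It is the only one: the forward difference in n of
-- Σ_h (-1)^h a_h C(n, j - h) is the same kind of sum with a_j dropped, so if such a sum vanishes for
-- all large n then a_0 = … = a_{j-1} = 0 by induction, and the sum is the constant (-1)^j a_j.

module Submission where

open import Defs
open import Data.Nat using (ℕ; suc; s≤s; _≤_; _≥_; _⊔_)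
import Data.Nat.Properties as ℕ
open import Data.Nat.Combinatorics using (_C_)
open import Data.Nat.ListAction using (sum)
open import Data.Fin using (Fin)
open import Data.Product using (_×_; _,_; ∃)
open import Data.Rational using (ℚ; 1ℚ)
open import Function.Properties.Inverse using (↔-trans; ↔-sym)
open import Relation.Binary.PropositionalEquality using (_≡_; cong; trans; sym; module ≡-Reasoning)

module BinomialExpansion where

  open import Data.Nat as ℕ using (ℕ; zero; suc; _≥_)
  import Data.Nat.Properties as ℕ
  open import Data.Nat.Combinatorics using (_C_; nCk+nC[k+1]≡[n+1]C[k+1])
  open import Data.Fin using (Fin; toℕ; inject₁; fromℕ)
  open import Data.Product using (Σ; _,_)
  open import Data.Sum using (_⊎_; inj₁; inj₂)
  open import Data.Integer as ℤ using ()
  import Data.Integer.Properties as ℤ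
  open import Data.List using (List; []; _∷_; map; foldr; tabulate)
  open import Data.List.Properties using (map-tabulate; tabulate-cong)
  open import Data.Rational using (ℚ; -_; _+_; _*_; _-_; 0ℚ; 1ℚ; toℚᵘ)
  open import Data.Rational.Properties
    using (neg-distrib-+; neg-distribˡ-*; neg-injective; *-identityˡ; *-identityʳ; +-identityʳ;
           toℚᵘ-injective; toℚᵘ-fromℚᵘ; toℚᵘ-homo-+; +-0-group)
  open import Data.Rational.Solver using (module +-*-Solver)
  open import Data.Rational.Unnormalised as ℚᵘ using (ℚᵘ; mkℚᵘ; *≡*)
  import Data.Rational.Unnormalised.Properties as ℚᵘ
  open import Algebra.Properties.Group +-0-group using (x∙y⁻¹≈ε⇒x≈y; x≈y⇒x∙y⁻¹≈ε)
  open import Function using (_∘_)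
  open import Relation.Binary.PropositionalEquality

  ℕ→ℚᵘ : ℕ → ℚᵘ
  ℕ→ℚᵘ m = mkℚᵘ (ℤ.+ m) 0

  ℕ→ℚᵘ-+ : ∀ a b → ℕ→ℚᵘ (a ℕ.+ b) ℚᵘ.≃ ℕ→ℚᵘ a ℚᵘ.+ ℕ→ℚᵘ b
  ℕ→ℚᵘ-+ a b = *≡* (begin
    ℤ.+ (a ℕ.+ b) ℤ.* ℤ.+ 1                          ≡⟨ ℤ.*-identityʳ _ ⟩
    ℤ.+ (a ℕ.+ b)                                   ≡⟨ ℤ.pos-+ a b ⟩
    ℤ.+ a ℤ.+ ℤ.+ b                                  ≡⟨ cong₂ ℤ._+_ (ℤ.*-identityʳ (ℤ.+ a)) (ℤ.*-identityʳ (ℤ.+ b)) ⟨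
    ℤ.+ a ℤ.* ℤ.+ 1 ℤ.+ ℤ.+ b ℤ.* ℤ.+ 1              ≡⟨ ℤ.*-identityʳ _ ⟨
    (ℤ.+ a ℤ.* ℤ.+ 1 ℤ.+ ℤ.+ b ℤ.* ℤ.+ 1) ℤ.* ℤ.+ 1  ∎)
    where open ≡-Reasoning

  ℕ→ℚ-+ : ∀ a b → ℕ→ℚ (a ℕ.+ b) ≡ ℕ→ℚ a + ℕ→ℚ b
  ℕ→ℚ-+ a b = toℚᵘ-injective (begin
    toℚᵘ (ℕ→ℚ (a ℕ.+ b))            ≈⟨ toℚᵘ-fromℚᵘ (ℕ→ℚᵘ (a ℕ.+ b)) ⟩
    ℕ→ℚᵘ (a ℕ.+ b)                  ≈⟨ ℕ→ℚᵘ-+ a b ⟩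
    ℕ→ℚᵘ a ℚᵘ.+ ℕ→ℚᵘ b              ≈⟨ ℚᵘ.+-cong (toℚᵘ-fromℚᵘ (ℕ→ℚᵘ a)) (toℚᵘ-fromℚᵘ (ℕ→ℚᵘ b)) ⟨
    toℚᵘ (ℕ→ℚ a) ℚᵘ.+ toℚᵘ (ℕ→ℚ b)  ≈⟨ toℚᵘ-homo-+ (ℕ→ℚ a) (ℕ→ℚ b) ⟨
    toℚᵘ (ℕ→ℚ a + ℕ→ℚ b)            ∎)
    where open ℚᵘ.≃-Reasoning

  ℕ→ℚ-pascal : ∀ n j → ℕ→ℚ (suc n C suc j) ≡ ℕ→ℚ (n C j) + ℕ→ℚ (n C suc j)
  ℕ→ℚ-pascal n j = trans (cong ℕ→ℚ (sym (nCk+nC[k+1]≡[n+1]C[k+1] n j))) (ℕ→ℚ-+ (n C j) (n C suc j))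

  sgn*x≡0⇒x≡0 : ∀ j x → sgn j * x ≡ 0ℚ → x ≡ 0ℚ
  sgn*x≡0⇒x≡0 zero    x eq = trans (sym (*-identityˡ x)) eq
  sgn*x≡0⇒x≡0 (suc j) x eq = sgn*x≡0⇒x≡0 j x (neg-injective (trans (neg-distribˡ-* (sgn j) x) eq))

  inject₁⊎fromℕ : ∀ {j} (h : Fin (suc j)) → (Σ (Fin j) λ h′ → h ≡ inject₁ h′) ⊎ h ≡ fromℕ j
  inject₁⊎fromℕ {zero}  Fin.zero    = inj₂ refl
  inject₁⊎fromℕ {suc j} Fin.zero    = inj₁ (Fin.zero , refl)
  inject₁⊎fromℕ {suc j} (Fin.suc h) with inject₁⊎fromℕ h
  ... | inj₁ (h′ , eq) = inj₁ (Fin.suc h′ , cong Fin.suc eq)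
  ... | inj₂ eq        = inj₂ (cong Fin.suc eq)

  private
    open +-*-Solver

    difference-step : ∀ x u v y z → (x * (u + v) - y) - (x * v - z) ≡ x * u - (y - z)
    difference-step = solve 5 (λ x u v y z →
      (x :* (u :+ v) :- y) :- (x :* v :- z) := x :* u :- (y :- z)) refl

    difference-base : ∀ x v y → (x * (1ℚ + v) - y) - (x * v - y) ≡ x
    difference-base = solve 3 (λ x v y →
      (x :* (con 1ℚ :+ v) :- y) :- (x :* v :- y) := x) refl

    linear-step : ∀ a b u y z → (a - b) * u - (y - z) ≡ (a * u - y) - (b * u - z)
    linear-step = solve 5 (λ a b u y z →
      (a :- b) :* u :- (y :- z) := (a :* u :- y) :- (b :* u :- z)) refl

    top-step : ∀ u w → 0ℚ * u - w ≡ - w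
    top-step = solve 2 (λ u w → con 0ℚ :* u :- w := :- w) refl

    ones-step : ∀ u v → 1ℚ * (u + v) - u ≡ v
    ones-step = solve 2 (λ u v → con 1ℚ :* (u :+ v) :- u := v) refl

  alternatingSum : (j : ℕ) → (Fin (suc j) → ℚ) → ℕ → ℚ
  alternatingSum zero    a n = a Fin.zero
  alternatingSum (suc j) a n = a Fin.zero * ℕ→ℚ (n C suc j) - alternatingSum j (a ∘ Fin.suc) n

  sumℚ : List ℚ → ℚ
  sumℚ = foldr _+_ 0ℚ

  sumℚ-map-neg : ∀ xs → sumℚ (map -_ xs) ≡ - sumℚ xs
  sumℚ-map-neg []       = refl
  sumℚ-map-neg (x ∷ xs) = trans (cong (- x +_) (sumℚ-map-neg xs)) (sym (neg-distrib-+ x _))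

  expansion-suc : ∀ j a n →
    expansion (suc j) a n ≡ a Fin.zero * ℕ→ℚ (n C suc j) - expansion j (a ∘ Fin.suc) n
  expansion-suc j a n = cong₂ _+_ (*-identityˡ (a Fin.zero * ℕ→ℚ (n C suc j))) (begin
    sumℚ (map (term (suc j) a) (tabulate Fin.suc))     ≡⟨ cong sumℚ (map-tabulate Fin.suc (term (suc j) a)) ⟩
    sumℚ (tabulate (term (suc j) a ∘ Fin.suc))         ≡⟨ cong sumℚ (tabulate-cong λ h → sym (neg-distribˡ-* (sgn (toℕ h)) (a (Fin.suc h) * ℕ→ℚ (n C (j ℕ.∸ toℕ h))))) ⟩
    sumℚ (tabulate (-_ ∘ term j (a ∘ Fin.suc)))        ≡⟨ cong sumℚ (map-tabulate (term j (a ∘ Fin.suc)) (-_)) ⟨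
    sumℚ (map -_ (tabulate (term j (a ∘ Fin.suc))))    ≡⟨ sumℚ-map-neg (tabulate (term j (a ∘ Fin.suc))) ⟩
    - sumℚ (tabulate (term j (a ∘ Fin.suc)))           ≡⟨ cong (-_ ∘ sumℚ) (map-tabulate (λ h → h) (term j (a ∘ Fin.suc))) ⟨
    - expansion j (a ∘ Fin.suc) n                     ∎)
    where
    open ≡-Reasoning
    term : (j : ℕ) → (Fin (suc j) → ℚ) → Fin (suc j) → ℚ
    term j a h = sgn (toℕ h) * (a h * ℕ→ℚ (n C (j ℕ.∸ toℕ h)))

  expansion≡alternatingSum : ∀ j a n → expansion j a n ≡ alternatingSum j a n
  expansion≡alternatingSum zero    a n = trans (+-identityʳ _) (trans (*-identityˡ _) (*-identityʳ (a Fin.zero)))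
  expansion≡alternatingSum (suc j) a n =
    trans (expansion-suc j a n) (cong (λ t → a Fin.zero * ℕ→ℚ (n C suc j) - t) (expansion≡alternatingSum j (a ∘ Fin.suc) n))

  alternatingSum-Δ : ∀ j (c : Fin (suc (suc j)) → ℚ) n →
    alternatingSum (suc j) c (suc n) - alternatingSum (suc j) c n ≡ alternatingSum j (c ∘ inject₁) n
  alternatingSum-Δ zero c n =
    trans (cong (λ t → (c Fin.zero * t - c₁) - (c Fin.zero * ℕ→ℚ (n C 1) - c₁)) (ℕ→ℚ-pascal n 0))
          (difference-base (c Fin.zero) (ℕ→ℚ (n C 1)) c₁)
    where c₁ = c (Fin.suc Fin.zero)
  alternatingSum-Δ (suc j) c n = begin
    (c₀ * ℕ→ℚ (suc n C suc (suc j)) - S (suc n)) - (c₀ * ℕ→ℚ (n C suc (suc j)) - S n)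
      ≡⟨ cong (λ t → (c₀ * t - S (suc n)) - (c₀ * ℕ→ℚ (n C suc (suc j)) - S n)) (ℕ→ℚ-pascal n (suc j)) ⟩
    (c₀ * (ℕ→ℚ (n C suc j) + ℕ→ℚ (n C suc (suc j))) - S (suc n)) - (c₀ * ℕ→ℚ (n C suc (suc j)) - S n)
      ≡⟨ difference-step c₀ _ _ (S (suc n)) (S n) ⟩
    c₀ * ℕ→ℚ (n C suc j) - (S (suc n) - S n)
      ≡⟨ cong (λ t → c₀ * ℕ→ℚ (n C suc j) - t) (alternatingSum-Δ j (c ∘ Fin.suc) n) ⟩
    alternatingSum (suc j) (c ∘ inject₁) n ∎
    where
    open ≡-Reasoning
    c₀ = c Fin.zero
    S = alternatingSum (suc j) (c ∘ Fin.suc)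

  alternatingSum-homo-− : ∀ j a b n →
    alternatingSum j (λ h → a h - b h) n ≡ alternatingSum j a n - alternatingSum j b n
  alternatingSum-homo-− zero    a b n = refl
  alternatingSum-homo-− (suc j) a b n =
    trans (cong (λ t → (a Fin.zero - b Fin.zero) * ℕ→ℚ (n C suc j) - t) (alternatingSum-homo-− j (a ∘ Fin.suc) (b ∘ Fin.suc) n))
          (linear-step (a Fin.zero) (b Fin.zero) _ _ _)

  alternatingSum-top : ∀ j c n → (∀ h → c (inject₁ h) ≡ 0ℚ) → alternatingSum j c n ≡ sgn j * c (fromℕ j)
  alternatingSum-top zero    c n _    = sym (*-identityˡ (c Fin.zero))
  alternatingSum-top (suc j) c n low = begin
    c Fin.zero * ℕ→ℚ (n C suc j) - alternatingSum j (c ∘ Fin.suc) n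
      ≡⟨ cong₂ (λ x y → x * ℕ→ℚ (n C suc j) - y) (low Fin.zero) (alternatingSum-top j (c ∘ Fin.suc) n (low ∘ Fin.suc)) ⟩
    0ℚ * ℕ→ℚ (n C suc j) - sgn j * c (fromℕ (suc j))
      ≡⟨ top-step (ℕ→ℚ (n C suc j)) (sgn j * c (fromℕ (suc j))) ⟩
    - (sgn j * c (fromℕ (suc j)))
      ≡⟨ neg-distribˡ-* (sgn j) _ ⟩
    sgn (suc j) * c (fromℕ (suc j)) ∎
    where open ≡-Reasoning

  alternatingSum-Δ-eventually-0 : ∀ j c N → (∀ n → n ≥ N → alternatingSum (suc j) c n ≡ 0ℚ) →
    ∀ n → n ≥ N → alternatingSum j (c ∘ inject₁) n ≡ 0ℚ
  alternatingSum-Δ-eventually-0 j c N vanish n n≥N = begin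
    alternatingSum j (c ∘ inject₁) n                                ≡⟨ alternatingSum-Δ j c n ⟨
    alternatingSum (suc j) c (suc n) - alternatingSum (suc j) c n  ≡⟨ cong₂ _-_ (vanish (suc n) (ℕ.m≤n⇒m≤1+n n≥N)) (vanish n n≥N) ⟩
    0ℚ                                                             ∎
    where open ≡-Reasoning

  alternatingSum-eventually-0 : ∀ j c N → (∀ n → n ≥ N → alternatingSum j c n ≡ 0ℚ) → ∀ h → c h ≡ 0ℚ
  alternatingSum-eventually-0 zero    c N vanish Fin.zero = vanish N ℕ.≤-refl
  alternatingSum-eventually-0 (suc j) c N vanish h with inject₁⊎fromℕ h
  ... | inj₁ (h′ , refl) = alternatingSum-eventually-0 j (c ∘ inject₁) N (alternatingSum-Δ-eventually-0 j c N vanish) h′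
  ... | inj₂ refl        = sgn*x≡0⇒x≡0 (suc j) (c (fromℕ (suc j))) (begin
    sgn (suc j) * c (fromℕ (suc j))  ≡⟨ alternatingSum-top (suc j) c N low ⟨
    alternatingSum (suc j) c N       ≡⟨ vanish N ℕ.≤-refl ⟩
    0ℚ                               ∎)
    where
    open ≡-Reasoning
    low : ∀ h → c (inject₁ h) ≡ 0ℚ
    low = alternatingSum-eventually-0 j (c ∘ inject₁) N (alternatingSum-Δ-eventually-0 j c N vanish)

  alternatingSum-injective : ∀ j a b N → (∀ n → n ≥ N → alternatingSum j a n ≡ alternatingSum j b n) → ∀ h → a h ≡ b h
  alternatingSum-injective j a b N agree h = x∙y⁻¹≈ε⇒x≈y (a h) (b h)
    (alternatingSum-eventually-0 j (λ h → a h - b h) N (λ n n≥N →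
      trans (alternatingSum-homo-− j a b n) (x≈y⇒x∙y⁻¹≈ε (agree n n≥N))) h)

  alternatingSum-ones : ∀ j m → alternatingSum j (λ _ → 1ℚ) (suc m) ≡ ℕ→ℚ (m C j)
  alternatingSum-ones zero    m = refl
  alternatingSum-ones (suc j) m = begin
    1ℚ * ℕ→ℚ (suc m C suc j) - alternatingSum j (λ _ → 1ℚ) (suc m)  ≡⟨ cong₂ (λ u v → 1ℚ * u - v) (ℕ→ℚ-pascal m j) (alternatingSum-ones j m) ⟩
    1ℚ * (ℕ→ℚ (m C j) + ℕ→ℚ (m C suc j)) - ℕ→ℚ (m C j)               ≡⟨ ones-step (ℕ→ℚ (m C j)) (ℕ→ℚ (m C suc j)) ⟩
    ℕ→ℚ (m C suc j)                                                  ∎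
    where open ≡-Reasoning

  expansion-injective : ∀ j a b N → (∀ n → n ≥ N → expansion j a n ≡ expansion j b n) → ∀ h → a h ≡ b h
  expansion-injective j a b N agree = alternatingSum-injective j a b N λ n n≥N →
    trans (sym (expansion≡alternatingSum j a n)) (trans (agree n n≥N) (expansion≡alternatingSum j b n))

  expansion-ones : ∀ j m → expansion j (λ _ → 1ℚ) (suc m) ≡ ℕ→ℚ (m C j)
  expansion-ones j m = trans (expansion≡alternatingSum j (λ _ → 1ℚ) (suc m)) (alternatingSum-ones j m)

module HookTableaux where

  open import Data.Bool using (Bool; true; false; T; not; _∧_)
  open import Data.Bool.Properties using (T-∧; ∧-identityʳ; T-irrelevant)
  open import Data.Bool.ListAction using (all)
  open import Data.Nat as ℕ using (ℕ; zero; suc; _+_; _∸_; _<_; _≤_; z≤n; s≤s; _<ᵇ_)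
  import Data.Nat.Properties as ℕ
  open import Data.Nat.Combinatorics using (_C_; nCk+nC[k+1]≡[n+1]C[k+1])
  open import Data.Nat.ListAction using (sum)
  open import Data.Fin using (Fin)
  import Data.Fin.Properties as Fin
  open import Data.Fin.Subset using (Subset; inside; outside; ∣_∣; ⊥; ∁)
  open import Data.Fin.Subset.Properties using (∣⊥∣≡0; ∣p∣≤n; ∣∁p∣≡n∸∣p∣)
  open import Data.Vec using ([]; _∷_)
  open import Data.List using (List; []; _∷_; _++_; length; concat; map; upTo; [_])
  import Data.List.Properties as List
  open import Data.List.Membership.Propositional using (_∈_; _∉_)
  open import Data.List.Membership.Propositional.Properties
    using (∈-++⁺ˡ; ∈-++⁺ʳ; ∈-++⁻; ∈-∃++; ∈-map⁺; ∈-map⁻; ∈-upTo⁺; ∈-upTo⁻)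
  open import Data.List.Relation.Unary.Any as Any using (here; there)
  open import Data.List.Relation.Unary.Any.Properties using (any⁺; any⁻)
  open import Data.List.Relation.Unary.All as All using ([]; _∷_)
  import Data.List.Relation.Unary.All.Properties as All
  open import Data.List.Relation.Unary.AllPairs using ([]; _∷_)
  open import Data.List.Relation.Unary.Unique.Propositional using (Unique)
  open import Data.Product as Product using (Σ; _×_; _,_; proj₁; proj₂; uncurry)
  open import Data.Sum as Sum using (_⊎_; inj₁; inj₂; [_,_]′)
  open import Data.Sum.Function.Propositional using (_⊎-↔_)
  open import Data.Empty using (⊥-elim)
  open import Function using (_∘_; id)
  open import Function.Bundles using (Equivalence; _↔_; mk↔ₛ′; Injection)
  open import Function.Properties.Inverse using (↔-trans; ↔-sym; ↔⇒↣)
  open import Relation.Nullary using (¬_; yes; no)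
  open import Relation.Binary.PropositionalEquality hiding ([_])

  -- Increasing lists and the pigeonhole principle

  T-∧⁺ : ∀ {a b} → T a → T b → T (a ∧ b)
  T-∧⁺ ta tb = Equivalence.from T-∧ (ta , tb)

  T-∧⁻ : ∀ {a b} → T (a ∧ b) → T a × T b
  T-∧⁻ {a} = Equivalence.to (T-∧ {a})

  ∈⇒member : ∀ {x xs} → x ∈ xs → T (member x xs)
  ∈⇒member {x} = any⁺ _ ∘ Any.map λ { refl → ℕ.≡⇒≡ᵇ x x refl }

  member⇒∈ : ∀ {x} xs → T (member x xs) → x ∈ xs
  member⇒∈ xs = Any.map (sym ∘ ℕ.≡ᵇ⇒≡ _ _) ∘ any⁻ _ xs

  ∉⇒not-member : ∀ {x} xs → x ∉ xs → T (not (member x xs))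
  ∉⇒not-member {x} xs x∉ with member x xs in eq
  ... | true  = x∉ (member⇒∈ xs (subst T (sym eq) _))
  ... | false = _

  not-member⇒∉ : ∀ {x} xs → T (not (member x xs)) → x ∉ xs
  not-member⇒∉ {x} xs not-mem x∈ with member x xs | ∈⇒member x∈
  ... | true | _ = not-mem

  increasing⇒tail : ∀ x xs → T (increasing (x ∷ xs)) → T (increasing xs)
  increasing⇒tail x []       _   = _
  increasing⇒tail x (y ∷ ys) inc = proj₂ (T-∧⁻ {x ℕ.<ᵇ y} inc)

  increasing⇒head< : ∀ x xs {y} → T (increasing (x ∷ xs)) → y ∈ xs → x < y
  increasing⇒head< x (y ∷ ys) inc y∈ with T-∧⁻ {x ℕ.<ᵇ y} inc
  ... | x<ᵇy , inc′ with y∈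
  ...   | here refl = ℕ.<ᵇ⇒< x y x<ᵇy
  ...   | there y∈ys = ℕ.<-trans (ℕ.<ᵇ⇒< x y x<ᵇy) (increasing⇒head< y ys inc′ y∈ys)

  increasing-unique : ∀ xs ys → T (increasing xs) → T (increasing ys) →
    (∀ {z} → z ∈ xs → z ∈ ys) → (∀ {z} → z ∈ ys → z ∈ xs) → xs ≡ ys
  increasing-unique []       []       _    _    _   _   = refl
  increasing-unique []       (y ∷ ys) _    _    _   ys⊆ with () ← ys⊆ (here refl)
  increasing-unique (x ∷ xs) []       _    _    xs⊆ _   with () ← xs⊆ (here refl)
  increasing-unique (x ∷ xs) (y ∷ ys) incx incy xs⊆ ys⊆ =
    cong₂ _∷_ x≡y (increasing-unique xs ys (increasing⇒tail x xs incx) (increasing⇒tail y ys incy) tail⊆ tail⊇)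
    where
    x≡y : x ≡ y
    x≡y with xs⊆ (here refl) | ys⊆ (here refl)
    ... | here x≡y  | _         = x≡y
    ... | there _   | here y≡x  = sym y≡x
    ... | there x∈  | there y∈  = ⊥-elim (ℕ.<-asym (increasing⇒head< y ys incy x∈) (increasing⇒head< x xs incx y∈))
    tail⊆ : ∀ {z} → z ∈ xs → z ∈ ys
    tail⊆ z∈ with xs⊆ (there z∈)
    ... | here refl = ⊥-elim (ℕ.<-irrefl x≡y (increasing⇒head< x xs incx z∈))
    ... | there z∈′ = z∈′
    tail⊇ : ∀ {z} → z ∈ ys → z ∈ xs
    tail⊇ z∈ with ys⊆ (there z∈)
    ... | here refl = ⊥-elim (ℕ.<-irrefl (sym x≡y) (increasing⇒head< y ys incy z∈))
    ... | there z∈′ = z∈′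

  Unique-insert : ∀ (xs ys : List ℕ) {y} → Unique (xs ++ ys) → y ∉ xs ++ ys → Unique (xs ++ y ∷ ys)
  Unique-insert []       ys u y∉ = All.tabulate (λ { z∈ refl → y∉ z∈ }) ∷ u
  Unique-insert (x ∷ xs) ys {y} (x∉ ∷ u) y∉ =
    All.++⁺ (All.++⁻ˡ xs x∉) ((λ { refl → y∉ (here refl) }) ∷ All.++⁻ʳ xs x∉) ∷ Unique-insert xs ys u (y∉ ∘ there)

  Unique-++⇒disjoint : ∀ (xs ys : List ℕ) {z} → Unique (xs ++ ys) → z ∈ xs → z ∉ ys
  Unique-++⇒disjoint (x ∷ xs) ys (x∉ ∷ u) (here refl) z∈ys = All.lookup (All.++⁻ʳ xs x∉) z∈ys refl
  Unique-++⇒disjoint (x ∷ xs) ys (x∉ ∷ u) (there z∈xs) = Unique-++⇒disjoint xs ys u z∈xs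

  pigeonhole : ∀ n xs → length xs ≤ n → (∀ {i} → 1 ≤ i → i ≤ n → i ∈ xs) →
    (∀ {x} → x ∈ xs → 1 ≤ x × x ≤ n) × Unique xs
  pigeonhole zero    []  _ _ = (λ ()) , []
  pigeonhole (suc n) xs len covers with ∈-∃++ (covers (s≤s z≤n) ℕ.≤-refl)
  ... | ys , zs , refl = bounds , Unique-insert ys zs (proj₂ IH) n+1∉
    where
    covers′ : ∀ {i} → 1 ≤ i → i ≤ n → i ∈ ys ++ zs
    covers′ 1≤i i≤n with ∈-++⁻ ys (covers 1≤i (ℕ.m≤n⇒m≤1+n i≤n))
    ... | inj₁ i∈ys         = ∈-++⁺ˡ i∈ys
    ... | inj₂ (here refl)  = ⊥-elim (ℕ.1+n≰n i≤n)
    ... | inj₂ (there i∈zs) = ∈-++⁺ʳ ys i∈zs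
    IH = pigeonhole n (ys ++ zs) (ℕ.s≤s⁻¹ (subst (_≤ suc n) (List.length-++-sucʳ ys (suc n) zs) len)) covers′
    n+1∉ : suc n ∉ ys ++ zs
    n+1∉ n+1∈ = ℕ.1+n≰n (proj₂ (proj₁ IH n+1∈))
    weaken : ∀ {x} → 1 ≤ x × x ≤ n → 1 ≤ x × x ≤ suc n
    weaken (1≤x , x≤n) = 1≤x , ℕ.m≤n⇒m≤1+n x≤n
    bounds : ∀ {x} → x ∈ ys ++ suc n ∷ zs → 1 ≤ x × x ≤ suc n
    bounds x∈ with ∈-++⁻ ys x∈
    ... | inj₁ x∈ys         = weaken (proj₁ IH (∈-++⁺ˡ x∈ys))
    ... | inj₂ (here refl)  = s≤s z≤n , ℕ.≤-refl
    ... | inj₂ (there x∈zs) = weaken (proj₁ IH (∈-++⁺ʳ ys x∈zs))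

  -- Subsets of a given size

  SubsetOfSize : ℕ → ℕ → Set
  SubsetOfSize m k = Σ (Subset m) λ p → ∣ p ∣ ≡ k

  SubsetOfSize-≡ : ∀ {m k} {p q : Subset m} {∣p∣≡k : ∣ p ∣ ≡ k} {∣q∣≡k : ∣ q ∣ ≡ k} →
    p ≡ q → _≡_ {A = SubsetOfSize m k} (p , ∣p∣≡k) (q , ∣q∣≡k)
  SubsetOfSize-≡ {∣p∣≡k = e} {e′} refl = cong (_ ,_) (ℕ.≡-irrelevant e e′)

  ∣p∣≡0⇒p≡⊥ : ∀ {m} {p : Subset m} → ∣ p ∣ ≡ 0 → p ≡ ⊥
  ∣p∣≡0⇒p≡⊥ {p = []}          _ = refl
  ∣p∣≡0⇒p≡⊥ {p = outside ∷ p} e = cong (outside ∷_) (∣p∣≡0⇒p≡⊥ e)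

  SubsetOfSize-0 : ∀ m → Fin 1 ↔ SubsetOfSize m 0
  SubsetOfSize-0 m = mk↔ₛ′ (λ _ → ⊥ , ∣⊥∣≡0 m) (λ _ → Fin.zero)
    (λ (_ , e) → SubsetOfSize-≡ (sym (∣p∣≡0⇒p≡⊥ e))) (λ { Fin.zero → refl ; (Fin.suc ()) })

  SubsetOfSize-empty : ∀ k → Fin 0 ↔ SubsetOfSize 0 (suc k)
  SubsetOfSize-empty k = mk↔ₛ′ (λ ()) (λ { ([] , ()) }) (λ { ([] , ()) }) (λ ())

  SubsetOfSize-suc : ∀ m k → (SubsetOfSize m k ⊎ SubsetOfSize m (suc k)) ↔ SubsetOfSize (suc m) (suc k)
  SubsetOfSize-suc m k = mk↔ₛ′ to from to∘from from∘to
    where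
    to : SubsetOfSize m k ⊎ SubsetOfSize m (suc k) → SubsetOfSize (suc m) (suc k)
    to (inj₁ (p , e)) = inside ∷ p , cong suc e
    to (inj₂ (p , e)) = outside ∷ p , e
    from : SubsetOfSize (suc m) (suc k) → SubsetOfSize m k ⊎ SubsetOfSize m (suc k)
    from (inside ∷ p , e)  = inj₁ (p , ℕ.suc-injective e)
    from (outside ∷ p , e) = inj₂ (p , e)
    to∘from : ∀ p → to (from p) ≡ p
    to∘from (inside ∷ p , e)  = SubsetOfSize-≡ refl
    to∘from (outside ∷ p , e) = refl
    from∘to : ∀ p → from (to p) ≡ p
    from∘to (inj₁ (p , e)) = cong inj₁ (SubsetOfSize-≡ refl)
    from∘to (inj₂ (p , e)) = refl

  binomial↔SubsetOfSize : ∀ m k → Fin (m C k) ↔ SubsetOfSize m k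
  binomial↔SubsetOfSize m       zero    = SubsetOfSize-0 m
  binomial↔SubsetOfSize zero    (suc k) = SubsetOfSize-empty k
  binomial↔SubsetOfSize (suc m) (suc k) =
    subst (λ n → Fin n ↔ SubsetOfSize (suc m) (suc k)) (nCk+nC[k+1]≡[n+1]C[k+1] m k)
      (↔-trans Fin.+↔⊎ (↔-trans (binomial↔SubsetOfSize m k ⊎-↔ binomial↔SubsetOfSize m (suc k)) (SubsetOfSize-suc m k)))

  Fin-↔-injective : ∀ {a b} → Fin a ↔ Fin b → a ≡ b
  Fin-↔-injective a↔b = ℕ.≤-antisym (≤-of a↔b) (≤-of (↔-sym a↔b))
    where
    ≤-of : ∀ {a b} → Fin a ↔ Fin b → a ≤ b
    ≤-of a↔b = Fin.injective⇒≤ (Injection.injective (↔⇒↣ a↔b))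

  -- Hook tableaux

  window-empty : ∀ {s x} → s ≤ x → ¬ x < s + 0
  window-empty {s} {x} s≤x x<s+0 = ℕ.<⇒≱ x<s+0 (subst (_≤ x) (sym (ℕ.+-identityʳ s)) s≤x)

  window-shift : ∀ {s x m} → s ≤ x → x ≢ s → x < s + suc m → suc s ≤ x × x < suc s + m
  window-shift {s} {x} {m} s≤x x≢s x<s+1+m = ℕ.≤∧≢⇒< s≤x (x≢s ∘ sym) , subst (x <_) (ℕ.+-suc s m) x<s+1+m

  -- selected s p lists s + i for the positions i of p; with s = 2 the subsets of Fin m
  -- stand for sets of entries among 2, …, m + 1.
  selected : ∀ {m} → ℕ → Subset m → List ℕ
  selected s []            = []
  selected s (inside ∷ p)  = s ∷ selected (suc s) p
  selected s (outside ∷ p) = selected (suc s) p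

  selected-≥ : ∀ {m} s (p : Subset m) {x} → x ∈ selected s p → s ≤ x
  selected-≥ s (inside ∷ p)  (here refl) = ℕ.≤-refl
  selected-≥ s (inside ∷ p)  (there x∈)  = ℕ.<⇒≤ (selected-≥ (suc s) p x∈)
  selected-≥ s (outside ∷ p) x∈          = ℕ.<⇒≤ (selected-≥ (suc s) p x∈)

  selected-< : ∀ {m} s (p : Subset m) {x} → x ∈ selected s p → x < s + m
  selected-< {suc m} s (inside ∷ p)  (here refl) = ℕ.m<m+n s (s≤s z≤n)
  selected-< {suc m} s (inside ∷ p)  {x} (there x∈) = subst (x <_) (sym (ℕ.+-suc s m)) (selected-< (suc s) p x∈)
  selected-< {suc m} s (outside ∷ p) {x} x∈        = subst (x <_) (sym (ℕ.+-suc s m)) (selected-< (suc s) p x∈)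

  selected-increasing : ∀ {m} x s (p : Subset m) → x < s → T (increasing (x ∷ selected s p))
  selected-increasing x s []            _   = _
  selected-increasing x s (inside ∷ p)  x<s = T-∧⁺ (ℕ.<⇒<ᵇ x<s) (selected-increasing s (suc s) p ℕ.≤-refl)
  selected-increasing x s (outside ∷ p) x<s = selected-increasing x (suc s) p (ℕ.m<n⇒m<1+n x<s)

  length-selected : ∀ {m} s (p : Subset m) → length (selected s p) ≡ ∣ p ∣
  length-selected s []            = refl
  length-selected s (inside ∷ p)  = cong suc (length-selected (suc s) p)
  length-selected s (outside ∷ p) = length-selected (suc s) p

  selected⊎selected-∁ : ∀ {m} s (p : Subset m) {x} → s ≤ x → x < s + m → x ∈ selected s p ⊎ x ∈ selected s (∁ p)
  selected⊎selected-∁ {zero}  s [] s≤x x<s+0 = ⊥-elim (window-empty s≤x x<s+0)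
  selected⊎selected-∁ {suc m} s (b ∷ p) {x} s≤x x<s+m with x ℕ.≟ s
  ... | yes refl = here-on b
    where
    here-on : ∀ b → s ∈ selected s (b ∷ p) ⊎ s ∈ selected s (∁ (b ∷ p))
    here-on inside  = inj₁ (here refl)
    here-on outside = inj₂ (here refl)
  ... | no x≢s = there-on b (uncurry (selected⊎selected-∁ (suc s) p) (window-shift s≤x x≢s x<s+m))
    where
    there-on : ∀ b → x ∈ selected (suc s) p ⊎ x ∈ selected (suc s) (∁ p) → x ∈ selected s (b ∷ p) ⊎ x ∈ selected s (∁ (b ∷ p))
    there-on inside  = Sum.map there id
    there-on outside = Sum.map id there

  selected-injective : ∀ {m} s (p q : Subset m) → selected s p ≡ selected s q → p ≡ q
  selected-injective s []            []            _  = refl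
  selected-injective s (inside ∷ p)  (inside ∷ q)  eq = cong (inside ∷_) (selected-injective (suc s) p q (List.∷-injectiveʳ eq))
  selected-injective s (outside ∷ p) (outside ∷ q) eq = cong (outside ∷_) (selected-injective (suc s) p q eq)
  selected-injective s (inside ∷ p)  (outside ∷ q) eq = ⊥-elim (ℕ.1+n≰n (selected-≥ (suc s) q (subst (s ∈_) eq (here refl))))
  selected-injective s (outside ∷ p) (inside ∷ q)  eq = ⊥-elim (ℕ.1+n≰n (selected-≥ (suc s) p (subst (s ∈_) (sym eq) (here refl))))

  indicator : (ℕ → Bool) → ℕ → (m : ℕ) → Subset m
  indicator P s zero    = []
  indicator P s (suc m) = P s ∷ indicator P (suc s) m

  ∁-indicator : ∀ P s m → ∁ (indicator P s m) ≡ indicator (not ∘ P) s m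
  ∁-indicator P s zero    = refl
  ∁-indicator P s (suc m) = cong (not (P s) ∷_) (∁-indicator P (suc s) m)

  selected-indicator⁻ : ∀ P s m {x} → x ∈ selected s (indicator P s m) → T (P x)
  selected-indicator⁻ P s (suc m) x∈ with P s in eq
  selected-indicator⁻ P s (suc m) (here refl) | true = subst T (sym eq) _
  selected-indicator⁻ P s (suc m) (there x∈)  | true = selected-indicator⁻ P (suc s) m x∈
  selected-indicator⁻ P s (suc m) x∈          | false = selected-indicator⁻ P (suc s) m x∈

  selected-indicator⁺ : ∀ P s m {x} → T (P x) → s ≤ x → x < s + m → x ∈ selected s (indicator P s m)
  selected-indicator⁺ P s zero    _  s≤x x<s+0 = ⊥-elim (window-empty s≤x x<s+0)
  selected-indicator⁺ P s (suc m) {x} Px s≤x x<s+m with x ℕ.≟ s | P s in eq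
  ... | yes refl | true  = here refl
  ... | yes refl | false = ⊥-elim (subst T eq Px)
  ... | no x≢s   | true  = there (uncurry (selected-indicator⁺ P (suc s) m Px) (window-shift s≤x x≢s x<s+m))
  ... | no x≢s   | false = uncurry (selected-indicator⁺ P (suc s) m Px) (window-shift s≤x x≢s x<s+m)

  sum-column : ∀ k → sum (column k) ≡ k
  sum-column zero    = refl
  sum-column (suc k) = cong suc (sum-column k)

  hookShape : ℕ → ℕ → List ℕ
  hookShape m k = hook (suc m) (sum (column k)) (column k)

  sum-hookShape : ∀ {m k} → k ≤ suc m → sum (hookShape m k) ≡ suc m
  sum-hookShape {m} {k} k≤1+m =
    trans (cong (λ j → suc m ∸ j + j) (sum-column k)) (ℕ.m∸n+n≡m k≤1+m)

  hookTableau : ∀ {m} → Subset m → List (List ℕ)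
  hookTableau p = (1 ∷ selected 2 (∁ p)) ∷ map [_] (selected 2 p)

  columnsOK-hook : ∀ x r ys → columnsOK ((x ∷ r) ∷ map [_] ys) ≡ increasing (x ∷ ys)
  columnsOK-hook x r []       = refl
  columnsOK-hook x r (y ∷ ys) = cong₂ _∧_ (trans (cong ((x <ᵇ y) ∧_) (belowOK-[] r)) (∧-identityʳ (x <ᵇ y))) (columnsOK-hook y [] ys)
    where
    belowOK-[] : ∀ r → belowOK r [] ≡ true
    belowOK-[] []      = refl
    belowOK-[] (_ ∷ _) = refl

  hasShape-column⁺ : ∀ ys → T (hasShape (map [_] ys) (column (length ys)))
  hasShape-column⁺ []       = _
  hasShape-column⁺ (y ∷ ys) = hasShape-column⁺ ys

  hasShape-column⁻ : ∀ rs k → T (hasShape rs (column k)) → rs ≡ map [_] (concat rs) × length (concat rs) ≡ k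
  hasShape-column⁻ []                 zero    _     = refl , refl
  hasShape-column⁻ ((x ∷ []) ∷ rs)    (suc k) shape =
    Product.map (cong ((x ∷ []) ∷_)) (cong suc) (hasShape-column⁻ rs k shape)

  all-increasing-singletons : ∀ ys → T (all increasing (map [_] ys))
  all-increasing-singletons []       = _
  all-increasing-singletons (y ∷ ys) = all-increasing-singletons ys

  ∈-1…n⁺ : ∀ {n i} → 1 ≤ i → i ≤ n → i ∈ map suc (upTo n)
  ∈-1…n⁺ {i = suc j} _ j<n = ∈-map⁺ suc (∈-upTo⁺ j<n)

  ∈-1…n⁻ : ∀ {n i} → i ∈ map suc (upTo n) → 1 ≤ i × i ≤ n
  ∈-1…n⁻ i∈ with j , j∈ , refl ← ∈-map⁻ suc i∈ = s≤s z≤n , ∈-upTo⁻ j∈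

  contentOK⁺ : ∀ t n → length (concat t) ≡ n → (∀ {i} → 1 ≤ i → i ≤ n → i ∈ concat t) → T (contentOK t n)
  contentOK⁺ t n len covers =
    T-∧⁺ (ℕ.≡⇒≡ᵇ _ _ len) (All.all⁻ _ (All.tabulate λ i∈ → ∈⇒member (uncurry covers (∈-1…n⁻ i∈))))

  contentOK⁻ : ∀ t n → T (contentOK t n) → length (concat t) ≡ n × (∀ {i} → 1 ≤ i → i ≤ n → i ∈ concat t)
  contentOK⁻ t n ok with T-∧⁻ {length (concat t) ℕ.≡ᵇ n} ok
  ... | len , covers = ℕ.≡ᵇ⇒≡ _ _ len , λ 1≤i i≤n → member⇒∈ (concat t) (All.lookup (All.all⁺ _ _ covers) (∈-1…n⁺ 1≤i i≤n))

  hookTableau-isSYT : ∀ {m} (p : Subset m) → T (isSYT (hookShape m ∣ p ∣) (hookTableau p))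
  hookTableau-isSYT {m} p = T-∧⁺ shape (T-∧⁺ rows (T-∧⁺ columns content))
    where
    open ≡-Reasoning
    k = ∣ p ∣
    column-entries = selected 2 p
    row-entries = selected 2 (∁ p)
    k≤m : k ≤ m
    k≤m = ∣p∣≤n p
    row-length : length (1 ∷ row-entries) ≡ suc m ∸ sum (column k)
    row-length = begin
      suc (length row-entries)  ≡⟨ cong suc (trans (length-selected 2 (∁ p)) (∣∁p∣≡n∸∣p∣ p)) ⟩
      suc (m ∸ k)               ≡⟨ ℕ.+-∸-assoc 1 k≤m ⟨
      suc m ∸ k                 ≡⟨ cong (suc m ∸_) (sum-column k) ⟨
      suc m ∸ sum (column k)    ∎
    shape : T (hasShape (hookTableau p) (hookShape m k))
    shape = T-∧⁺ (ℕ.≡⇒≡ᵇ _ _ row-length)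
      (subst (T ∘ hasShape (map [_] column-entries) ∘ column) (length-selected 2 p) (hasShape-column⁺ column-entries))
    rows : T (all increasing (hookTableau p))
    rows = T-∧⁺ (selected-increasing 1 2 (∁ p) (s≤s (s≤s z≤n))) (all-increasing-singletons column-entries)
    columns : T (columnsOK (hookTableau p))
    columns = subst T (sym (columnsOK-hook 1 row-entries column-entries)) (selected-increasing 1 2 p (s≤s (s≤s z≤n)))
    size≡ : sum (hookShape m k) ≡ suc m
    size≡ = sum-hookShape (ℕ.m≤n⇒m≤1+n k≤m)
    entries≡ : concat (hookTableau p) ≡ 1 ∷ row-entries ++ column-entries
    entries≡ = cong (λ ys → 1 ∷ row-entries ++ ys) (List.concat-map-[ column-entries ])
    content : T (contentOK (hookTableau p) (sum (hookShape m k)))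
    content = contentOK⁺ (hookTableau p) (sum (hookShape m k)) len covers
      where
      len : length (concat (hookTableau p)) ≡ sum (hookShape m k)
      len = begin
        length (concat (hookTableau p))                       ≡⟨ cong length entries≡ ⟩
        suc (length (row-entries ++ column-entries))          ≡⟨ cong suc (List.length-++ row-entries) ⟩
        suc (length row-entries + length column-entries)      ≡⟨ cong suc (cong₂ _+_ (trans (length-selected 2 (∁ p)) (∣∁p∣≡n∸∣p∣ p)) (length-selected 2 p)) ⟩
        suc (m ∸ k + k)                                       ≡⟨ cong suc (ℕ.m∸n+n≡m k≤m) ⟩
        suc m                                                 ≡⟨ size≡ ⟨
        sum (hookShape m k)                                   ∎
      covers : ∀ {i} → 1 ≤ i → i ≤ sum (hookShape m k) → i ∈ concat (hookTableau p)
      covers {suc zero}    _ _   = subst (1 ∈_) (sym entries≡) (here refl)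
      covers {suc (suc j)} _ i≤ = subst (suc (suc j) ∈_) (sym entries≡)
        (there ([ ∈-++⁺ʳ row-entries , ∈-++⁺ˡ ]′ (selected⊎selected-∁ 2 p (s≤s (s≤s z≤n)) (s≤s (subst (suc (suc j) ≤_) size≡ i≤)))))

  columnSubset : (m : ℕ) → List ℕ → Subset m
  columnSubset m ys = indicator (λ x → member x ys) 2 m

  selected-columnSubset : ∀ m ys → T (increasing ys) → (∀ {y} → y ∈ ys → 2 ≤ y × y < 2 + m) →
    selected 2 (columnSubset m ys) ≡ ys
  selected-columnSubset m ys inc bounds = increasing-unique _ ys
    (increasing⇒tail 1 (selected 2 (columnSubset m ys)) (selected-increasing 1 2 (columnSubset m ys) (s≤s (s≤s z≤n)))) inc
    (λ y∈ → member⇒∈ ys (selected-indicator⁻ _ 2 m y∈))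
    (λ y∈ → uncurry (selected-indicator⁺ _ 2 m (∈⇒member y∈)) (bounds y∈))

  firstRow-columnSubset : ∀ m x r ys → T (increasing (x ∷ r)) → (∀ {y} → y ∈ ys → 2 ≤ y) →
    length ((x ∷ r) ++ ys) ≡ suc m → (∀ {i} → 1 ≤ i → i ≤ suc m → i ∈ (x ∷ r) ++ ys) →
    1 ∷ selected 2 (∁ (columnSubset m ys)) ≡ x ∷ r
  firstRow-columnSubset m x r ys inc ys≥2 len covers = increasing-unique _ (x ∷ r)
    (selected-increasing 1 2 (∁ (columnSubset m ys)) (s≤s (s≤s z≤n))) inc ⊆row ⊇row
    where
    bounds-unique = pigeonhole (suc m) ((x ∷ r) ++ ys) (ℕ.≤-reflexive len) covers
    complement≡ : ∁ (columnSubset m ys) ≡ indicator (not ∘ λ z → member z ys) 2 m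
    complement≡ = ∁-indicator (λ z → member z ys) 2 m
    in-row : ∀ {z} → 1 ≤ z → z ≤ suc m → z ∉ ys → z ∈ x ∷ r
    in-row 1≤z z≤ z∉ = [ id , ⊥-elim ∘ z∉ ]′ (∈-++⁻ (x ∷ r) (covers 1≤z z≤))
    ⊆row : ∀ {z} → z ∈ 1 ∷ selected 2 (∁ (columnSubset m ys)) → z ∈ x ∷ r
    ⊆row (here refl) = in-row ℕ.≤-refl (s≤s z≤n) (λ 1∈ → ℕ.<-irrefl refl (ys≥2 1∈))
    ⊆row {z} (there z∈) = in-row (ℕ.<⇒≤ (selected-≥ 2 (∁ (columnSubset m ys)) z∈)) (ℕ.s≤s⁻¹ (selected-< 2 (∁ (columnSubset m ys)) z∈))
      (not-member⇒∉ ys (selected-indicator⁻ _ 2 m (subst (λ p → z ∈ selected 2 p) complement≡ z∈)))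
    ⊇row : ∀ {z} → z ∈ x ∷ r → z ∈ 1 ∷ selected 2 (∁ (columnSubset m ys))
    ⊇row {z} z∈ with proj₁ bounds-unique (∈-++⁺ˡ z∈) | z ℕ.≟ 1
    ... | _        | yes refl = here refl
    ... | 1≤z , z≤ | no z≢1   = there (subst (λ p → z ∈ selected 2 p) (sym complement≡)
      (selected-indicator⁺ _ 2 m (∉⇒not-member ys (Unique-++⇒disjoint (x ∷ r) ys (proj₂ bounds-unique) z∈))
        (ℕ.≤∧≢⇒< 1≤z (z≢1 ∘ sym)) (s≤s z≤)))

  isSYT⁻ : ∀ ν t → T (isSYT ν t) →
    T (hasShape t ν) × T (all increasing t) × T (columnsOK t) × T (contentOK t (sum ν))
  isSYT⁻ ν t syt with T-∧⁻ {hasShape t ν} syt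
  ... | shape , rest with T-∧⁻ {all increasing t} rest
  ...   | rows , rest′ = shape , rows , T-∧⁻ {columnsOK t} rest′

  hookSYT-row : ∀ {m k} r₀ rs → T (isSYT (hookShape m k) (r₀ ∷ rs)) → length r₀ ≡ suc m ∸ sum (column k)
  hookSYT-row {m} {k} r₀ rs syt = ℕ.≡ᵇ⇒≡ _ _ (proj₁ (T-∧⁻ {length r₀ ℕ.≡ᵇ (suc m ∸ sum (column k))} (proj₁ (isSYT⁻ (hookShape m k) (r₀ ∷ rs) syt))))

  hookSYT-column : ∀ {m k} r₀ rs → T (isSYT (hookShape m k) (r₀ ∷ rs)) → rs ≡ map [_] (concat rs) × length (concat rs) ≡ k
  hookSYT-column {m} {k} r₀ rs syt =
    hasShape-column⁻ rs k (proj₂ (T-∧⁻ {length r₀ ℕ.≡ᵇ (suc m ∸ sum (column k))} (proj₁ (isSYT⁻ (hookShape m k) (r₀ ∷ rs) syt))))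

  hookSYT-row≢[] : ∀ {m k} rs → k ≤ m → ¬ T (isSYT (hookShape m k) ([] ∷ rs))
  hookSYT-row≢[] {m} {k} rs k≤m syt = ℕ.0≢1+n (begin
    0                       ≡⟨ hookSYT-row {m} {k} [] rs syt ⟩
    suc m ∸ sum (column k)  ≡⟨ cong (suc m ∸_) (sum-column k) ⟩
    suc m ∸ k               ≡⟨ ℕ.+-∸-assoc 1 k≤m ⟩
    suc (m ∸ k)             ∎)
    where open ≡-Reasoning

  hookTableau-columnSubset : ∀ {m k} x r rs → k ≤ m → T (isSYT (hookShape m k) ((x ∷ r) ∷ rs)) →
    hookTableau (columnSubset m (concat rs)) ≡ (x ∷ r) ∷ rs
  hookTableau-columnSubset {m} {k} x r rs k≤m syt with isSYT⁻ (hookShape m k) ((x ∷ r) ∷ rs) syt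
  ... | _ , rows , cols , content = cong₂ _∷_ first-row (trans (cong (map [_]) column-entries) (sym rs≡))
    where
    ys = concat rs
    rs≡ : rs ≡ map [_] ys
    rs≡ = proj₁ (hookSYT-column {m} {k} (x ∷ r) rs syt)
    size≡ : sum (hookShape m k) ≡ suc m
    size≡ = sum-hookShape (ℕ.m≤n⇒m≤1+n k≤m)
    inc-column : T (increasing (x ∷ ys))
    inc-column = subst T (columnsOK-hook x r ys) (subst (λ rs → T (columnsOK ((x ∷ r) ∷ rs))) rs≡ cols)
    len : length ((x ∷ r) ++ ys) ≡ suc m
    len = trans (proj₁ (contentOK⁻ ((x ∷ r) ∷ rs) _ content)) size≡
    covers : ∀ {i} → 1 ≤ i → i ≤ suc m → i ∈ (x ∷ r) ++ ys
    covers {i} 1≤i i≤ = proj₂ (contentOK⁻ ((x ∷ r) ∷ rs) _ content) 1≤i (subst (i ≤_) (sym size≡) i≤)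
    bounds = proj₁ (pigeonhole (suc m) ((x ∷ r) ++ ys) (ℕ.≤-reflexive len) covers)
    ys-bounds : ∀ {y} → y ∈ ys → 2 ≤ y × y < 2 + m
    ys-bounds y∈ = ℕ.≤-<-trans (proj₁ (bounds (here refl))) (increasing⇒head< x ys inc-column y∈)
                 , s≤s (proj₂ (bounds (∈-++⁺ʳ (x ∷ r) y∈)))
    column-entries : selected 2 (columnSubset m ys) ≡ ys
    column-entries = selected-columnSubset m ys (increasing⇒tail x ys inc-column) ys-bounds
    first-row : 1 ∷ selected 2 (∁ (columnSubset m ys)) ≡ x ∷ r
    first-row = firstRow-columnSubset m x r ys (proj₁ (T-∧⁻ {increasing (x ∷ r)} rows)) (proj₁ ∘ ys-bounds) len covers

  SYT-≡ : ∀ {ν t t′} {syt : T (isSYT ν t)} {syt′ : T (isSYT ν t′)} → t ≡ t′ → _≡_ {A = SYT ν} (t , syt) (t′ , syt′)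
  SYT-≡ {syt = syt} {syt′} refl = cong (_ ,_) (T-irrelevant syt syt′)

  columnSubset-selected : ∀ {m} (p : Subset m) → columnSubset m (concat (map [_] (selected 2 p))) ≡ p
  columnSubset-selected {m} p = selected-injective 2 _ p (begin
    selected 2 (columnSubset m (concat (map [_] (selected 2 p))))  ≡⟨ cong (selected 2 ∘ columnSubset m) (List.concat-map-[ selected 2 p ]) ⟩
    selected 2 (columnSubset m (selected 2 p))                    ≡⟨ selected-columnSubset m (selected 2 p) increasing-entries bounds ⟩
    selected 2 p                                                  ∎)
    where
    open ≡-Reasoning
    increasing-entries = increasing⇒tail 1 (selected 2 p) (selected-increasing 1 2 p (s≤s (s≤s z≤n)))
    bounds : ∀ {y} → y ∈ selected 2 p → 2 ≤ y × y < 2 + m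
    bounds y∈ = selected-≥ 2 p y∈ , selected-< 2 p y∈

  SubsetOfSize↔hookSYT : ∀ m k → k ≤ m → SubsetOfSize m k ↔ SYT (hookShape m k)
  SubsetOfSize↔hookSYT m k k≤m = mk↔ₛ′ to from to∘from from∘to
    where
    to : SubsetOfSize m k → SYT (hookShape m k)
    to (p , ∣p∣≡k) = hookTableau p , subst (λ k → T (isSYT (hookShape m k) (hookTableau p))) ∣p∣≡k (hookTableau-isSYT p)
    size : ∀ x r rs → T (isSYT (hookShape m k) ((x ∷ r) ∷ rs)) → ∣ columnSubset m (concat rs) ∣ ≡ k
    size x r rs syt = begin
      ∣ q ∣                                    ≡⟨ length-selected 2 q ⟨
      length (selected 2 q)                    ≡⟨ cong length (List.concat-map-[ selected 2 q ]) ⟨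
      length (concat (map [_] (selected 2 q))) ≡⟨ cong (length ∘ concat) (List.∷-injectiveʳ (hookTableau-columnSubset x r rs k≤m syt)) ⟩
      length (concat rs)                       ≡⟨ proj₂ (hookSYT-column {m} {k} (x ∷ r) rs syt) ⟩
      k                                        ∎
      where
      open ≡-Reasoning
      q = columnSubset m (concat rs)
    from : SYT (hookShape m k) → SubsetOfSize m k
    from ([] ∷ rs , syt)      = ⊥-elim (hookSYT-row≢[] rs k≤m syt)
    from ((x ∷ r) ∷ rs , syt) = columnSubset m (concat rs) , size x r rs syt
    to∘from : ∀ t → to (from t) ≡ t
    to∘from ([] ∷ rs , syt)      = ⊥-elim (hookSYT-row≢[] rs k≤m syt)
    to∘from ((x ∷ r) ∷ rs , syt) = SYT-≡ (hookTableau-columnSubset x r rs k≤m syt)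
    from∘to : ∀ p → from (to p) ≡ p
    from∘to (p , _) = SubsetOfSize-≡ (columnSubset-selected p)

  hookSYT-count : ∀ m k → k ≤ m → HasSYTCount (hookShape m k) (m C k)
  hookSYT-count m k k≤m = ↔-trans (binomial↔SubsetOfSize m k) (SubsetOfSize↔hookSYT m k k≤m)

open BinomialExpansion using (expansion-injective; expansion-ones)
open HookTableaux using (Fin-↔-injective; sum-column; hookShape; hookSYT-count)

binomial≡expansion-ones : ∀ k m → ℕ→ℚ (m C k) ≡ expansion (sum (column k)) (λ _ → 1ℚ) (suc m)
binomial≡expansion-ones k m = sym (trans (expansion-ones (sum (column k)) m) (cong (λ j → ℕ→ℚ (m C j)) (sum-column k)))

expansion≡expansion-ones : ∀ k (a : Fin (suc (sum (column k))) → ℚ) m → k ≤ m →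
  ∃ (λ f → HasSYTCount (hookShape m k) f × ℕ→ℚ f ≡ expansion (sum (column k)) a (suc m)) →
  expansion (sum (column k)) a (suc m) ≡ expansion (sum (column k)) (λ _ → 1ℚ) (suc m)
expansion≡expansion-ones k a m k≤m (f , count , f≡expansion) = begin
  expansion (sum (column k)) a (suc m)            ≡⟨ sym f≡expansion ⟩
  ℕ→ℚ f                                           ≡⟨ cong ℕ→ℚ (Fin-↔-injective (↔-trans count (↔-sym (hookSYT-count m k k≤m)))) ⟩
  ℕ→ℚ (m C k)                                     ≡⟨ binomial≡expansion-ones k m ⟩
  expansion (sum (column k)) (λ _ → 1ℚ) (suc m)  ∎
  where open ≡-Reasoning

lemma2p6 : (k : ℕ) →
    IsCoeffFamily (column k) (λ _ → 1ℚ)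
    × ((a : Fin (suc (sum (column k))) → ℚ) → IsCoeffFamily (column k) a → (h : Fin (suc (sum (column k)))) → a h ≡ 1ℚ)
lemma2p6 k = (suc k , λ { (suc m) (s≤s k≤m) → m C k , hookSYT-count m k k≤m , binomial≡expansion-ones k m }) , uniqueness
  where
  uniqueness : (a : Fin (suc (sum (column k))) → ℚ) → IsCoeffFamily (column k) a → ∀ h → a h ≡ 1ℚ
  uniqueness a (N , valid) = expansion-injective (sum (column k)) a (λ _ → 1ℚ) (suc (N ⊔ k)) agree
    where
    agree : ∀ n → n ≥ suc (N ⊔ k) → expansion (sum (column k)) a n ≡ expansion (sum (column k)) (λ _ → 1ℚ) n
    agree (suc m) (s≤s N⊔k≤m) =
      expansion≡expansion-ones k a m (ℕ.m⊔n≤o⇒n≤o N k N⊔k≤m) (valid (suc m) (ℕ.m≤n⇒m≤1+n (ℕ.m⊔n≤o⇒m≤o N k N⊔k≤m)))
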